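{- Let $\mathbf{d}=(d_1,\dots,d_n)$ be a graphical sequence with $\sum_{i=1}^n d_i=4(n-1)-4$, $5\le d_1<n-1$ and $d_n=3$. Then $\mathbf{d}$ admits a realization which is a $C_4$-pivotable graph.
   Context: A degree sequence is non-increasing, $d_1\ge\dots\ge d_n\ge 0$; it is graphical if some simple graph on $v_1,\dots,v_n$ has $\deg(v_i)=d_i$ (a realization). A simple graph $G$ on $n$ vertices with exactly $2n-4$ edges is $C_4$-pivotable if $G$ contains an induced cycle $C$ of length 4 and two spanning trees whose edge sets have exactly two common edges, both of which are edges of $C$. -}

module Defs where

open import Data.Nat using (ℕ; zero; suc; _+_; _*_; _∸_; _≤_; _<_)
open import Data.Bool using (Bool; true; false; _∧_)
open import Data.Fin using (Fin; toℕ; fromℕ) renaming (_≤_ to _≤ᶠ_)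
open import Data.List using (List; []; _∷_; length; filter; map; sum; allFin; cartesianProduct; head; last)
open import Data.List.Relation.Unary.Unique.Propositional using (Unique)
open import Data.List.Relation.Unary.Linked using (Linked)
open import Data.Maybe using (just)
open import Data.Product using (Σ; _×_; _,_; ∃; ∃-syntax; proj₁; proj₂)
open import Data.Sum using (_⊎_)
open import Relation.Binary.PropositionalEquality using (_≡_; _≢_)
open import Relation.Binary.Construct.Closure.ReflexiveTransitive using (Star)
open import Relation.Nullary using (¬_)
open import Relation.Nullary.Decidable using (⌊_⌋)
open import Data.Nat using (_<ᵇ_)

-- A simple graph on the vertex set Fin n (vertex v_(i+1) is  i : Fin n):
-- a symmetric, irreflexive Boolean adjacency relation.
record Graph (n : ℕ) : Set where
  field
    adj    : Fin n → Fin n → Bool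
    sym    : ∀ i j → adj i j ≡ adj j i
    irrefl : ∀ i → adj i i ≡ false
open Graph public

Adj : ∀ {n} → Graph n → Fin n → Fin n → Set
Adj G i j = adj G i j ≡ true

countTrue : List Bool → ℕ
countTrue [] = 0
countTrue (true ∷ bs) = suc (countTrue bs)
countTrue (false ∷ bs) = countTrue bs

degree : ∀ {n} → Graph n → Fin n → ℕ
degree {n} G i = countTrue (map (adj G i) (allFin n))

edgeCount : ∀ {n} → Graph n → ℕ
edgeCount {n} G =
  countTrue (map (λ p → (toℕ (proj₁ p) <ᵇ toℕ (proj₂ p)) ∧ adj G (proj₁ p) (proj₂ p))
                 (cartesianProduct (allFin n) (allFin n)))

NonIncreasing : ∀ {n} → (Fin n → ℕ) → Set
NonIncreasing {n} d = ∀ (i j : Fin n) → i ≤ᶠ j → d j ≤ d i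

Realizes : ∀ {n} → Graph n → (Fin n → ℕ) → Set
Realizes {n} G d = ∀ (i : Fin n) → degree G i ≡ d i

Graphical : ∀ {n} → (Fin n → ℕ) → Set
Graphical {n} d = NonIncreasing d × Σ (Graph n) (λ G → Realizes G d)

_⊆ᴳ_ : ∀ {n} → Graph n → Graph n → Set
_⊆ᴳ_ {n} H G = ∀ (i j : Fin n) → Adj H i j → Adj G i j

Connected : ∀ {n} → Graph n → Set
Connected {n} G = ∀ (u v : Fin n) → Star (Adj G) u v

IsCycle : ∀ {n} → Graph n → List (Fin n) → Set
IsCycle G [] = Data.Empty.⊥ where import Data.Empty
IsCycle G (x ∷ []) = Data.Empty.⊥ where import Data.Empty
IsCycle G (x ∷ y ∷ []) = Data.Empty.⊥ where import Data.Empty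
IsCycle G (x ∷ y ∷ z ∷ zs) =
  Unique (x ∷ y ∷ z ∷ zs) × Linked (Adj G) (x ∷ y ∷ z ∷ zs) × Adj G (last′ z zs) x
  where
  last′ : _ → List _ → _
  last′ a [] = a
  last′ a (b ∷ bs) = last′ b bs

Acyclic : ∀ {n} → Graph n → Set
Acyclic {n} G = ∀ (c : List (Fin n)) → ¬ IsCycle G c

SpanningTree : ∀ {n} → Graph n → Graph n → Set
SpanningTree G T = (T ⊆ᴳ G) × Connected T × Acyclic T

InducedC4 : ∀ {n} → Graph n → Fin n → Fin n → Fin n → Fin n → Set
InducedC4 G a b c e =
  Unique (a ∷ b ∷ c ∷ e ∷ []) ×
  Adj G a b × Adj G b c × Adj G c e × Adj G e a ×
  adj G a c ≡ false × adj G b e ≡ false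

C4Edge : ∀ {n} → Fin n → Fin n → Fin n → Fin n → Fin n → Fin n → Set
C4Edge a b c e i j =
  ((i ≡ a × j ≡ b) ⊎ (i ≡ b × j ≡ a)) ⊎
  ((i ≡ b × j ≡ c) ⊎ (i ≡ c × j ≡ b)) ⊎
  ((i ≡ c × j ≡ e) ⊎ (i ≡ e × j ≡ c)) ⊎
  ((i ≡ e × j ≡ a) ⊎ (i ≡ a × j ≡ e))

_∩ᴳ_ : ∀ {n} → Graph n → Graph n → Graph n
_∩ᴳ_ {n} S T = record
  { adj = λ i j → adj S i j ∧ adj T i j
  ; sym = λ i j → cong₂ _∧_ (Graph.sym S i j) (Graph.sym T i j)
  ; irrefl = λ i → cong (λ b → b ∧ adj T i i) (irrefl S i)
  }
  where open import Relation.Binary.PropositionalEquality using (cong; cong₂)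

C4Pivotable : ∀ {n} → Graph n → Set
C4Pivotable {n} G =
  edgeCount G ≡ 2 * n ∸ 4 ×
  Σ (Fin n) λ a → Σ (Fin n) λ b → Σ (Fin n) λ c → Σ (Fin n) λ e →
    InducedC4 G a b c e ×
    Σ (Graph n) λ T₁ → Σ (Graph n) λ T₂ →
      SpanningTree G T₁ × SpanningTree G T₂ ×
      edgeCount (T₁ ∩ᴳ T₂) ≡ 2 ×
      (∀ (i j : Fin n) → Adj (T₁ ∩ᴳ T₂) i j → C4Edge a b c e i j)

{-# OPTIONS --safe #-}
-- Read backwards, d becomes non-decreasing with a 3 in front, and it suffices to realise every
-- such sequence (sum 4(n-1)-4, last entry at least 5) by the union of two spanning trees T₁, T₂
-- that share exactly two edges, both on an induced 4-cycle.  The trees are given by parent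
-- pointers along which a height function strictly decreases, which makes them connected and
-- acyclic.  For n = 10 the degree sum forces the sequence 3,…,3,5, realised by an
-- explicit pair of trees.  For larger n the second entry is a 3 as well; deleting the first
-- entry and lowering the first entry ≥ 4 (at a vertex z) gives a shorter sequence of the same
-- kind, and a realisation of it is extended by an edge split: a T₁-edge x–y lying neither in T₂
-- nor on the 4-cycle is replaced by a new vertex w of degree 3, with x–w–y in T₁ and w a leaf
-- below z in T₂.  Carrying two vertex-disjoint such edges guarantees one that avoids z, and the
-- new edge x–w takes over the role of the edge used.

module Submission where

open import Defs hiding (sym)
open import Data.Nat using (ℕ; suc; _*_; _∸_; _≤_; _<_)
open import Data.Fin using (Fin; zero; fromℕ)
open import Data.List using (map; allFin)
open import Data.Nat.ListAction using (sum)
open import Data.Product using (Σ; _×_)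
open import Relation.Binary.PropositionalEquality using (_≡_)

open import Data.Nat using (zero; _+_; z≤n; s≤s; _<ᵇ_)
import Data.Nat as ℕ
open import Data.Nat.Properties hiding (_≟_; suc-injective)
open import Data.Nat.Tactic.RingSolver using (solve-∀)
open import Data.Bool using (Bool; true; false; _∧_; _∨_; not; if_then_else_; T)
import Data.Bool as Bool
open import Data.Bool.Properties using (∨-comm; ∧-comm; ∧-zeroʳ; ∧-identityʳ; ∨-identityʳ)
open import Data.Empty using (⊥-elim)
open import Data.Fin using (suc; toℕ; inject₁; inject; fromℕ<; Fin′; opposite; #_) renaming (_≤_ to _≤ᶠ_)
open import Data.Fin.Properties
  using ( _≟_; suc-injective; toℕ-injective; toℕ-inject; toℕ-inject₁; toℕ-fromℕ; toℕ-fromℕ<; toℕ<n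
        ; opposite-prop; opposite-involutive; all?; ¬∀⟶∃¬-smallest )
open import Data.Fin.Permutation using (Permutation′; _⟨$⟩ʳ_; _⟨$⟩ˡ_; inverseˡ; inverseʳ)
import Data.Fin.Permutation as Perm
open import Data.List using (List; []; _∷_; tabulate; _++_; cartesianProduct)
open import Data.List.Properties using (map-++; map-∘)
open import Data.List.Membership.Propositional using (_∈_)
open import Data.List.Relation.Unary.Any using (here; there)
open import Data.List.Relation.Unary.All as All using (All; []; _∷_)
open import Data.List.Relation.Unary.AllPairs using ([]; _∷_)
open import Data.List.Relation.Unary.Linked as Linked using (Linked; []; [-]; _∷_)
open import Data.List.Relation.Unary.Unique.Propositional using (Unique)
import Data.List.Relation.Unary.Unique.Propositional.Properties as Unique
import Data.List.Relation.Unary.Unique.DecPropositional as UniqueDec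
open import Data.Product using (_,_; proj₁; proj₂; ∃)
import Data.Product as ×
open import Data.Sum using (_⊎_; inj₁; inj₂)
import Data.Sum as ⊎
open import Data.Vec using (Vec; []; _∷_)
import Data.Vec as Vec
open import Function using (_∘_; id; mk⇔)
open import Relation.Binary using (tri<; tri≈; tri>)
open import Relation.Binary.PropositionalEquality
open import Relation.Binary.Construct.Closure.ReflexiveTransitive using (Star; ε; _◅_; _◅◅_; reverse)
open import Relation.Nullary using (¬_; Dec; yes; no; does; contradiction)
open import Relation.Nullary.Decidable
  using (dec-true; dec-false; does-⇔; ¬?; _×-dec_; _⊎-dec_; _→-dec_; True; toWitness; from-yes; from-no)
open import Algebra.Properties.CommutativeMonoid.Sum +-0-commutativeMonoid
  using (sum-cong-≗; ∑-distrib-+; ∑-comm; sum-init-last; sum-permute)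
  renaming (sum to ∑)

infix 7 _==_

_==_ : ∀ {n} → Fin n → Fin n → Bool
i == j = does (i ≟ j)

==-refl : ∀ {n} (i : Fin n) → (i == i) ≡ true
==-refl i = dec-true (i ≟ i) refl

==⇒≡ : ∀ {n} {i j : Fin n} → (i == j) ≡ true → i ≡ j
==⇒≡ {i = i} {j} i==j with i ≟ j | i==j
... | yes i≡j | _ = i≡j

≢⇒==-false : ∀ {n} {i j : Fin n} → i ≢ j → (i == j) ≡ false
≢⇒==-false {i = i} {j} = dec-false (i ≟ j)

==-false⇒≢ : ∀ {n} {i j : Fin n} → (i == j) ≡ false → i ≢ j
==-false⇒≢ {i = i} {j} i≠j i≡j with i ≟ j | i≠j
... | no i≢j | _ = i≢j i≡j

==-sym : ∀ {n} (i j : Fin n) → (i == j) ≡ (j == i)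
==-sym i j = does-⇔ (mk⇔ sym sym) (i ≟ j) (j ≟ i)

∨-trueˡ : ∀ {a} b → a ≡ true → (a ∨ b) ≡ true
∨-trueˡ b refl = refl

∨-trueʳ : ∀ a {b} → b ≡ true → (a ∨ b) ≡ true
∨-trueʳ true  _ = refl
∨-trueʳ false b = b

∨-true : ∀ a b → (a ∨ b) ≡ true → a ≡ true ⊎ b ≡ true
∨-true true  b _ = inj₁ refl
∨-true false b e = inj₂ e

∧-true : ∀ a b → (a ∧ b) ≡ true → a ≡ true × b ≡ true
∧-true true b e = refl , e

∨-true-falseʳ : ∀ a {b} → b ≡ false → (a ∨ b) ≡ true → a ≡ true
∨-true-falseʳ a refl a∨false = trans (sym (∨-identityʳ a)) a∨false

not-true : ∀ a → not a ≡ true → a ≡ false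
not-true false _ = refl

bit : Bool → ℕ
bit true  = 1
bit false = 0

bit-∨ : ∀ a b → (a ∧ b) ≡ false → bit (a ∨ b) ≡ bit a + bit b
bit-∨ true  false _ = refl
bit-∨ false b     _ = refl

count : ∀ {n} → (Fin n → Bool) → ℕ
count f = ∑ (bit ∘ f)

∑-mono-≤ : ∀ {n} {f g : Fin n → ℕ} → (∀ i → f i ≤ g i) → ∑ f ≤ ∑ g
∑-mono-≤ {zero}  f≤g = z≤n
∑-mono-≤ {suc n} f≤g = +-mono-≤ (f≤g zero) (∑-mono-≤ (f≤g ∘ suc))

∑-const : ∀ n c → ∑ {n} (λ _ → c) ≡ n * c
∑-const zero    c = refl
∑-const (suc n) c = cong (c +_) (∑-const n c)

*≤∑ : ∀ {n} c (f : Fin n → ℕ) → (∀ i → c ≤ f i) → n * c ≤ ∑ f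
*≤∑ {n} c f c≤f = subst (_≤ ∑ f) (∑-const n c) (∑-mono-≤ c≤f)

∑≤* : ∀ {n} c (f : Fin n → ℕ) → (∀ i → f i ≤ c) → ∑ f ≤ n * c
∑≤* {n} c f f≤c = subst (∑ f ≤_) (∑-const n c) (∑-mono-≤ f≤c)

+-mono-≤-equality : ∀ {a b c d} → a ≤ b → c ≤ d → a + c ≡ b + d → a ≡ b × c ≡ d
+-mono-≤-equality {a} {b} {c} {d} a≤b c≤d a+c≡b+d with m≤n⇒m<n∨m≡n a≤b | m≤n⇒m<n∨m≡n c≤d
... | inj₂ refl | _         = refl , +-cancelˡ-≡ a c d a+c≡b+d
... | inj₁ a<b  | inj₂ refl = contradiction a+c≡b+d (<⇒≢ (+-monoˡ-< c a<b))
... | inj₁ a<b  | inj₁ c<d  = contradiction a+c≡b+d (<⇒≢ (+-mono-< a<b c<d))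

∑-mono-≤-equality : ∀ {n} {f g : Fin n → ℕ} → (∀ i → f i ≤ g i) → ∑ f ≡ ∑ g → ∀ i → f i ≡ g i
∑-mono-≤-equality {suc n} f≤g ∑f≡∑g zero =
  proj₁ (+-mono-≤-equality (f≤g zero) (∑-mono-≤ (f≤g ∘ suc)) ∑f≡∑g)
∑-mono-≤-equality {suc n} f≤g ∑f≡∑g (suc i) =
  ∑-mono-≤-equality (f≤g ∘ suc) (proj₂ (+-mono-≤-equality (f≤g zero) (∑-mono-≤ (f≤g ∘ suc)) ∑f≡∑g)) i

count-false : ∀ {n} (f : Fin n → Bool) → (∀ i → f i ≡ false) → count f ≡ 0
count-false {n} f f≡false = trans (sum-cong-≗ (cong bit ∘ f≡false)) (trans (∑-const n 0) (*-zeroʳ n))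

count-== : ∀ {n} (j : Fin n) → count (_== j) ≡ 1
count-== {suc n} zero    = cong suc (count-false {n} (λ i → suc i == zero) (λ _ → refl))
count-== {suc n} (suc j) = count-== j

count-∨ : ∀ {n} (f g : Fin n → Bool) → (∀ i → (f i ∧ g i) ≡ false) →
  count (λ i → f i ∨ g i) ≡ count f + count g
count-∨ f g disjoint =
  trans (sum-cong-≗ (λ i → bit-∨ (f i) (g i) (disjoint i))) (∑-distrib-+ (bit ∘ f) (bit ∘ g))

count-split : ∀ {n} (f g : Fin n → Bool) → (∀ i → g i ≡ true → f i ≡ true) →
  count f ≡ count (λ i → f i ∧ not (g i)) + count g
count-split f g g⇒f = trans (sum-cong-≗ split) (∑-distrib-+ (λ i → bit (f i ∧ not (g i))) (bit ∘ g))
  where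
  split : ∀ i → bit (f i) ≡ bit (f i ∧ not (g i)) + bit (g i)
  split i with g i in gi
  ... | true  rewrite g⇒f i gi = refl
  ... | false rewrite ∧-identityʳ (f i) = sym (+-identityʳ _)

sum-map-tabulate : ∀ {A : Set} {n} (f : A → ℕ) (g : Fin n → A) → sum (map f (tabulate g)) ≡ ∑ (f ∘ g)
sum-map-tabulate {n = zero}  f g = refl
sum-map-tabulate {n = suc n} f g = cong (f (g zero) +_) (sum-map-tabulate f (g ∘ suc))

countTrue-map-tabulate : ∀ {A : Set} {n} (f : A → Bool) (g : Fin n → A) →
  countTrue (map f (tabulate g)) ≡ count (f ∘ g)
countTrue-map-tabulate {n = zero}  f g = refl
countTrue-map-tabulate {n = suc n} f g with f (g zero)
... | true  = cong suc (countTrue-map-tabulate f (g ∘ suc))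
... | false = countTrue-map-tabulate f (g ∘ suc)

countTrue-++ : ∀ xs ys → countTrue (xs ++ ys) ≡ countTrue xs + countTrue ys
countTrue-++ []           ys = refl
countTrue-++ (true ∷ xs)  ys = cong suc (countTrue-++ xs ys)
countTrue-++ (false ∷ xs) ys = countTrue-++ xs ys

countTrue-cartesianProduct : ∀ {A B : Set} {n} (f : A × B → Bool) (g : Fin n → A) (ys : List B) →
  countTrue (map f (cartesianProduct (tabulate g) ys)) ≡ ∑ (λ i → countTrue (map (λ y → f (g i , y)) ys))
countTrue-cartesianProduct {n = zero}  f g ys = refl
countTrue-cartesianProduct {n = suc n} f g ys = begin
  countTrue (map f (map (g zero ,_) ys ++ cartesianProduct (tabulate (g ∘ suc)) ys))
    ≡⟨ cong countTrue (map-++ f (map (g zero ,_) ys) _) ⟩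
  countTrue (map f (map (g zero ,_) ys) ++ map f (cartesianProduct (tabulate (g ∘ suc)) ys))
    ≡⟨ countTrue-++ (map f (map (g zero ,_) ys)) _ ⟩
  countTrue (map f (map (g zero ,_) ys)) + countTrue (map f (cartesianProduct (tabulate (g ∘ suc)) ys))
    ≡⟨ cong₂ _+_ (cong countTrue (sym (map-∘ ys))) (countTrue-cartesianProduct f (g ∘ suc) ys) ⟩
  countTrue (map (λ y → f (g zero , y)) ys) + ∑ (λ i → countTrue (map (λ y → f (g (suc i) , y)) ys)) ∎
  where open ≡-Reasoning

degree≡count : ∀ {n} (G : Graph n) i → degree G i ≡ count (adj G i)
degree≡count G i = countTrue-map-tabulate (adj G i) id

upperEdge : ∀ {n} → Graph n → Fin n → Fin n → Bool
upperEdge G i j = (toℕ i <ᵇ toℕ j) ∧ adj G i j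

edgeCount≡∑ : ∀ {n} (G : Graph n) → edgeCount G ≡ ∑ (λ i → count (upperEdge G i))
edgeCount≡∑ {n} G =
  trans (countTrue-cartesianProduct (λ p → upperEdge G (proj₁ p) (proj₂ p)) id (allFin n))
        (sum-cong-≗ (λ i → countTrue-map-tabulate (upperEdge G i) id))

<ᵇ-false : ∀ m n → ¬ (m < n) → (m <ᵇ n) ≡ false
<ᵇ-false m n m≮n with m <ᵇ n in eq
... | true  = contradiction (<ᵇ⇒< m n (subst T (sym eq) _)) m≮n
... | false = refl

<ᵇ-true : ∀ m n → m < n → (m <ᵇ n) ≡ true
<ᵇ-true m n m<n with m <ᵇ n in eq
... | true  = refl
... | false = ⊥-elim (subst T eq (<⇒<ᵇ m<n))

bit-adj≡upperEdges : ∀ {n} (G : Graph n) i j → bit (adj G i j) ≡ bit (upperEdge G i j) + bit (upperEdge G j i)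
bit-adj≡upperEdges G i j with <-cmp (toℕ i) (toℕ j)
... | tri< i<j _ j≮i rewrite <ᵇ-true _ _ i<j | <ᵇ-false _ _ j≮i = sym (+-identityʳ _)
... | tri> i≮j _ j<i rewrite <ᵇ-true _ _ j<i | <ᵇ-false _ _ i≮j | Graph.sym G j i = refl
... | tri≈ _ i≡j _ rewrite toℕ-injective i≡j | irrefl G j | ∧-zeroʳ (toℕ j <ᵇ toℕ j) = refl

handshake : ∀ {n} (G : Graph n) → ∑ (degree G) ≡ 2 * edgeCount G
handshake {n} G = begin
  ∑ (degree G)                              ≡⟨ sum-cong-≗ (degree≡count G) ⟩
  ∑ (λ i → ∑ (λ j → bit (adj G i j)))       ≡⟨ sum-cong-≗ (λ i → sum-cong-≗ (bit-adj≡upperEdges G i)) ⟩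
  ∑ (λ i → ∑ (λ j → U i j + U j i))         ≡⟨ sum-cong-≗ (λ i → ∑-distrib-+ (U i) (λ j → U j i)) ⟩
  ∑ (λ i → ∑ (U i) + ∑ (λ j → U j i))       ≡⟨ ∑-distrib-+ (λ i → ∑ (U i)) (λ i → ∑ (λ j → U j i)) ⟩
  S + ∑ (λ i → ∑ (λ j → U j i))             ≡⟨ cong (S +_) (∑-comm (λ i j → U j i)) ⟩
  S + S                                     ≡⟨ cong (S +_) (sym (+-identityʳ S)) ⟩
  2 * S                                     ≡⟨ cong (2 *_) (sym (edgeCount≡∑ G)) ⟩
  2 * edgeCount G                           ∎
  where
  open ≡-Reasoning
  U : Fin n → Fin n → ℕ
  U i j = bit (upperEdge G i j)
  S : ℕ
  S = ∑ (λ i → ∑ (U i))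

_∪ᴳ_ : ∀ {n} → Graph n → Graph n → Graph n
G ∪ᴳ H = record
  { adj    = λ i j → adj G i j ∨ adj H i j
  ; sym    = λ i j → cong₂ _∨_ (Graph.sym G i j) (Graph.sym H i j)
  ; irrefl = λ i → cong₂ _∨_ (irrefl G i) (irrefl H i)
  }

infix 4 _≈ᴳ_

_≈ᴳ_ : ∀ {n} → Graph n → Graph n → Set
G ≈ᴳ H = ∀ i j → adj G i j ≡ adj H i j

degree-cong : ∀ {n} {G H : Graph n} → G ≈ᴳ H → ∀ i → degree G i ≡ degree H i
degree-cong {G = G} {H} G≈H i =
  trans (degree≡count G i) (trans (sum-cong-≗ (cong bit ∘ G≈H i)) (sym (degree≡count H i)))

completeAvoiding : ∀ {n} → Fin n → Graph n
completeAvoiding x = record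
  { adj    = K
  ; sym    = K-sym
  ; irrefl = K-irrefl
  }
  where
  K : _ → _ → Bool
  K i j = (not (i == x) ∧ not (j == x)) ∧ not (i == j)
  K-sym : ∀ i j → K i j ≡ K j i
  K-sym i j rewrite ==-sym i j | ∧-comm (not (i == x)) (not (j == x)) = refl
  K-irrefl : ∀ i → K i i ≡ false
  K-irrefl i rewrite ==-refl i = ∧-zeroʳ _

linked-completeAvoiding : ∀ {n} (x : Fin n) ws → Unique ws → All (x ≢_) ws → Linked (Adj (completeAvoiding x)) ws
linked-completeAvoiding x []           _ _ = []
linked-completeAvoiding x (w ∷ [])     _ _ = [-]
linked-completeAvoiding x (w ∷ v ∷ ws) ((w≢v ∷ _) ∷ unique) (x≢w ∷ x≢v ∷ x∉ws) =
  K-wv ∷ linked-completeAvoiding x (v ∷ ws) unique (x≢v ∷ x∉ws)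
  where
  K-wv : ((not (w == x) ∧ not (v == x)) ∧ not (w == v)) ≡ true
  K-wv rewrite ≢⇒==-false (x≢w ∘ sym) | ≢⇒==-false (x≢v ∘ sym) | ≢⇒==-false w≢v = refl

lastOf : ∀ {A : Set} → A → List A → A
lastOf a []       = a
lastOf a (b ∷ bs) = lastOf b bs

penultimate : ∀ {A : Set} → A → A → List A → A
penultimate a b []       = a
penultimate a b (c ∷ cs) = penultimate b c cs

lastOf-∈ : ∀ {A : Set} (a : A) as → lastOf a as ∈ a ∷ as
lastOf-∈ a []       = here refl
lastOf-∈ a (b ∷ bs) = there (lastOf-∈ b bs)

penultimate-∈ : ∀ {A : Set} (a b : A) cs → penultimate a b cs ∈ a ∷ b ∷ cs
penultimate-∈ a b []       = here refl
penultimate-∈ a b (c ∷ cs) = there (penultimate-∈ b c cs)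

-- IsCycle reaches its last vertex through a local function, so the closing edge is
-- exposed by shortening the cycle: dropping a vertex keeps the list a cycle once the
-- complete graph avoiding the base vertex is added, and that adds no edge at the base.
cycle-closingEdge : ∀ {n} (G : Graph n) x y z zs → IsCycle G (x ∷ y ∷ z ∷ zs) → Adj G (lastOf z zs) x
cycle-closingEdge G x y z []       (_ , _ , closing) = closing
cycle-closingEdge G x y z (b ∷ bs) ((x≢y ∷ _ ∷ x∉bs) ∷ (_ ∷ y∉bs) ∷ (_ ∷ unique) , (xy ∷ _) , closing) =
  ∨-true-falseʳ _ K-closing (cycle-closingEdge (G ∪ᴳ K) x y b bs
    ( (x≢y ∷ x∉bs) ∷ y∉bs ∷ unique
    , ∨-trueˡ _ xy ∷ Linked.map (∨-trueʳ _)
                       (linked-completeAvoiding x (y ∷ b ∷ bs) (y∉bs ∷ unique) (x≢y ∷ x∉bs))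
    , ∨-trueˡ _ closing ))
  where
  K : Graph _
  K = completeAvoiding x
  K-closing : ((not (lastOf b bs == x) ∧ not (x == x)) ∧ not (lastOf b bs == x)) ≡ false
  K-closing rewrite ==-refl x | ∧-zeroʳ (not (lastOf b bs == x)) = refl

-- Trees given by parent pointers

record ParentTree (n : ℕ) : Set where
  field
    root         : Fin n
    parent       : Fin n → Fin n
    height       : Fin n → ℕ
    parent-lower : ∀ x → x ≢ root → height (parent x) < height x

module _ {n} (T : ParentTree n) where
  open ParentTree T

  child : Fin n → Fin n → Bool
  child i j = not (i == root) ∧ (j == parent i)

  edge : Fin n → Fin n → Bool
  edge i j = child i j ∨ child j i

  parent≢ : ∀ x → x ≢ root → parent x ≢ x
  parent≢ x x≢root px≡x = <-irrefl (cong height px≡x) (parent-lower x x≢root)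

  child-irrefl : ∀ i → child i i ≡ false
  child-irrefl i with i ≟ root
  ... | yes _      = refl
  ... | no i≢root = ≢⇒==-false (parent≢ i i≢root ∘ sym)

  treeGraph : Graph n
  treeGraph = record
    { adj    = edge
    ; sym    = λ i j → ∨-comm (child i j) (child j i)
    ; irrefl = λ i → cong (λ b → b ∨ b) (child-irrefl i)
    }

  child-parent : ∀ x → x ≢ root → child x (parent x) ≡ true
  child-parent x x≢root rewrite ≢⇒==-false x≢root | ==-refl (parent x) = refl

  child⇒parent : ∀ {i j} → child i j ≡ true → i ≢ root × j ≡ parent i
  child⇒parent {i} {j} i-child-j with ∧-true (not (i == root)) (j == parent i) i-child-j
  ... | i≠root , j==pi = ==-false⇒≢ (not-true _ i≠root) , ==⇒≡ j==pi

  child-asym : ∀ {i j} → child i j ≡ true → child j i ≡ false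
  child-asym {i} {j} i-child-j with j ≟ root | child⇒parent {i} {j} i-child-j
  ... | yes _      | _                = refl
  ... | no j≢root | i≢root , refl = ≢⇒==-false λ i≡pj →
    <-asym (parent-lower i i≢root) (subst (λ k → height k < height j) (sym i≡pj) (parent-lower j j≢root))

  edge-parent : ∀ x → x ≢ root → Adj treeGraph x (parent x)
  edge-parent x x≢root = ∨-trueˡ _ (child-parent x x≢root)

  edge-cases : ∀ {i j} → Adj treeGraph i j → (i ≢ root × j ≡ parent i) ⊎ (j ≢ root × i ≡ parent j)
  edge-cases {i} {j} e with ∨-true (child i j) (child j i) e
  ... | inj₁ i-child-j = inj₁ (child⇒parent i-child-j)
  ... | inj₂ j-child-i = inj₂ (child⇒parent j-child-i)

  path-to-root : ∀ k x → height x < k → Star (Adj treeGraph) x root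
  path-to-root (suc k) x (s≤s hx≤k) with x ≟ root
  ... | yes refl    = ε
  ... | no x≢root = edge-parent x x≢root ◅ path-to-root k (parent x) (≤-trans (parent-lower x x≢root) hx≤k)

  treeGraph-connected : Connected treeGraph
  treeGraph-connected u v =
    path-to-root _ u ≤-refl ◅◅ reverse (λ {i} {j} e → trans (Graph.sym treeGraph j i) e) (path-to-root _ v ≤-refl)

  -- After a step down to a child a path cannot step up again, as that would revisit a vertex.
  path-stays-descending : ∀ w₀ w₁ ws → Unique (w₀ ∷ w₁ ∷ ws) → Linked (Adj treeGraph) (w₀ ∷ w₁ ∷ ws) →
    w₁ ≢ root → w₀ ≡ parent w₁ →
    penultimate w₀ w₁ ws ≡ parent (lastOf w₁ ws) × lastOf w₁ ws ≢ root × height w₀ < height (lastOf w₁ ws)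
  path-stays-descending w₀ w₁ [] _ _ w₁≢root refl = refl , w₁≢root , parent-lower w₁ w₁≢root
  path-stays-descending w₀ w₁ (w₂ ∷ ws) ((_ ∷ w₀≢w₂ ∷ _) ∷ unique) (_ ∷ linked@(e₁₂ ∷ _)) w₁≢root refl
    with edge-cases e₁₂
  ... | inj₁ (_ , w₂≡pw₁)         = contradiction (sym w₂≡pw₁) w₀≢w₂
  ... | inj₂ (w₂≢root , w₁≡pw₂) with path-stays-descending w₁ w₂ ws unique linked w₂≢root w₁≡pw₂
  ...   | pen≡parent , last≢root , h₁<h = pen≡parent , last≢root , <-trans (parent-lower w₁ w₁≢root) h₁<h

  path-end-cases : ∀ w₀ w₁ ws → Unique (w₀ ∷ w₁ ∷ ws) → Linked (Adj treeGraph) (w₀ ∷ w₁ ∷ ws) →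
    height (lastOf w₁ ws) < height w₀ ⊎ (penultimate w₀ w₁ ws ≡ parent (lastOf w₁ ws) × lastOf w₁ ws ≢ root)
  path-end-cases w₀ w₁ ws unique linked@(e₀₁ ∷ linked′) with edge-cases e₀₁
  ... | inj₂ (w₁≢root , w₀≡pw₁) with path-stays-descending w₀ w₁ ws unique linked w₁≢root w₀≡pw₁
  ...   | pen≡parent , last≢root , _ = inj₂ (pen≡parent , last≢root)
  path-end-cases w₀ w₁ [] _ _ | inj₁ (w₀≢root , refl) = inj₁ (parent-lower w₀ w₀≢root)
  path-end-cases w₀ w₁ (w₂ ∷ ws) (_ ∷ unique) (_ ∷ linked′) | inj₁ (w₀≢root , refl)
    with path-end-cases w₁ w₂ ws unique linked′
  ... | inj₁ h<h₁ = inj₁ (<-trans h<h₁ (parent-lower w₀ w₀≢root))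
  ... | inj₂ ends = inj₂ ends

  treeGraph-acyclic : Acyclic treeGraph
  treeGraph-acyclic (x ∷ y ∷ z ∷ zs) cycle@(unique@((x≢y ∷ x∉) ∷ _) , linked , _)
    with edge-cases {lastOf z zs} {x} (cycle-closingEdge treeGraph x y z zs cycle)
  ... | inj₁ (l≢root , x≡pl) with path-end-cases x y (z ∷ zs) unique linked
  ...   | inj₁ hl<hx =
    <-asym hl<hx (subst (λ k → height k < height (lastOf z zs)) (sym x≡pl) (parent-lower (lastOf z zs) l≢root))
  ...   | inj₂ (pen≡pl , _) =
    All.lookup (x≢y ∷ x∉) (penultimate-∈ y z zs) (sym (trans pen≡pl (sym x≡pl)))
  treeGraph-acyclic (x ∷ y ∷ z ∷ zs) (unique@(_ ∷ y∉ ∷ _) , linked@(e-xy ∷ _) , _)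
    | inj₂ (x≢root , l≡px) with edge-cases e-xy
  ... | inj₁ (_ , y≡px)          = All.lookup y∉ (lastOf-∈ z zs) (trans y≡px (sym l≡px))
  ... | inj₂ (y≢root , x≡py) with path-stays-descending x y (z ∷ zs) unique linked y≢root x≡py
  ...   | _ , _ , hx<hl = <-asym hx<hl (subst (λ k → height k < height x) (sym l≡px) (parent-lower x x≢root))

  treeGraph-spanningTree : ∀ {G} → treeGraph ⊆ᴳ G → SpanningTree G treeGraph
  treeGraph-spanningTree T⊆G = T⊆G , treeGraph-connected , treeGraph-acyclic

module _ {n} (π : Permutation′ n) where

  ==-⟨$⟩ˡ : ∀ i j → (i == (π ⟨$⟩ˡ j)) ≡ ((π ⟨$⟩ʳ i) == j)
  ==-⟨$⟩ˡ i j = does-⇔ (mk⇔ (λ i≡ → trans (cong (π ⟨$⟩ʳ_) i≡) (inverseʳ π))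
                            (λ ≡j → trans (sym (inverseˡ π)) (cong (π ⟨$⟩ˡ_) ≡j)))
                       (i ≟ π ⟨$⟩ˡ j) (π ⟨$⟩ʳ i ≟ j)

  relabelGraph : Graph n → Graph n
  relabelGraph G = record
    { adj    = λ i j → adj G (π ⟨$⟩ʳ i) (π ⟨$⟩ʳ j)
    ; sym    = λ i j → Graph.sym G (π ⟨$⟩ʳ i) (π ⟨$⟩ʳ j)
    ; irrefl = λ i → irrefl G (π ⟨$⟩ʳ i)
    }

  degree-relabelGraph : ∀ G i → degree (relabelGraph G) i ≡ degree G (π ⟨$⟩ʳ i)
  degree-relabelGraph G i = begin
    degree (relabelGraph G) i                    ≡⟨ degree≡count (relabelGraph G) i ⟩
    count (λ j → adj G (π ⟨$⟩ʳ i) (π ⟨$⟩ʳ j))   ≡⟨ sum-permute (bit ∘ adj G (π ⟨$⟩ʳ i)) π ⟨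
    count (adj G (π ⟨$⟩ʳ i))                     ≡⟨ degree≡count G (π ⟨$⟩ʳ i) ⟨
    degree G (π ⟨$⟩ʳ i)                          ∎
    where open ≡-Reasoning

  relabelTree : ParentTree n → ParentTree n
  relabelTree T = record
    { root         = π ⟨$⟩ˡ root
    ; parent       = λ i → π ⟨$⟩ˡ parent (π ⟨$⟩ʳ i)
    ; height       = height ∘ (π ⟨$⟩ʳ_)
    ; parent-lower = λ i i≢root → subst (λ k → height k < height (π ⟨$⟩ʳ i)) (sym (inverseʳ π))
                       (parent-lower (π ⟨$⟩ʳ i) (i≢root ∘ trans (sym (inverseˡ π)) ∘ cong (π ⟨$⟩ˡ_)))
    }
    where open ParentTree T

  edge-relabelTree : ∀ T i j → edge (relabelTree T) i j ≡ edge T (π ⟨$⟩ʳ i) (π ⟨$⟩ʳ j)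
  edge-relabelTree T i j = cong₂ _∨_ (child-relabel i j) (child-relabel j i)
    where
    open ParentTree T
    child-relabel : ∀ i j → child (relabelTree T) i j ≡ child T (π ⟨$⟩ʳ i) (π ⟨$⟩ʳ j)
    child-relabel i j = cong₂ (λ p q → not p ∧ q) (==-⟨$⟩ˡ i root) (==-⟨$⟩ˡ j (parent (π ⟨$⟩ʳ i)))

module _ {n} (T : ParentTree n) (z : Fin n) where
  open ParentTree T

  attachLeaf : ParentTree (suc n)
  attachLeaf = record
    { root         = suc root
    ; parent       = λ { zero → suc z ; (suc u) → suc (parent u) }
    ; height       = λ { zero → suc (height z) ; (suc u) → height u }
    ; parent-lower = λ { zero _ → ≤-refl ; (suc u) u≢root → parent-lower u (u≢root ∘ cong suc) }
    }

  edge-attachLeaf-new : ∀ w → edge attachLeaf (suc w) zero ≡ (w == z)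
  edge-attachLeaf-new w rewrite ∧-zeroʳ (not (w == root)) = refl

module _ {n} (T : ParentTree n) (x : Fin n) (x≢root : x ≢ ParentTree.root T) where
  open ParentTree T

  -- heights are doubled to make room for the new vertex between x and its parent
  subdivide : ParentTree (suc n)
  subdivide = record
    { root         = suc root
    ; parent       = parent⁺
    ; height       = height⁺
    ; parent-lower = parent⁺-lower
    }
    where
    parent⁺ : Fin (suc n) → Fin (suc n)
    parent⁺ zero    = suc (parent x)
    parent⁺ (suc u) = if u == x then zero else suc (parent u)
    height⁺ : Fin (suc n) → ℕ
    height⁺ zero    = height x + height x
    height⁺ (suc u) = suc (height u + height u)
    parent⁺-lower : ∀ u → u ≢ suc root → height⁺ (parent⁺ u) < height⁺ u
    parent⁺-lower zero _ = subst (_≤ height x + height x) (cong suc (+-suc (height (parent x)) _))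
                             (+-mono-≤ (parent-lower x x≢root) (parent-lower x x≢root))
    parent⁺-lower (suc u) u≢root with u == x in u==x
    ... | true  = subst (λ k → height x + height x < suc (height k + height k)) (sym (==⇒≡ u==x)) ≤-refl
    ... | false = s≤s (+-mono-< (parent-lower u (u≢root ∘ cong suc)) (parent-lower u (u≢root ∘ cong suc)))

  onEdge : Fin n → Fin n → Bool
  onEdge a b = (a == x ∧ b == parent x) ∨ (a == parent x ∧ b == x)

  edge-subdivide-new : ∀ w → edge subdivide (suc w) zero ≡ (w == x ∨ w == parent x)
  edge-subdivide-new w with w == x in w==x
  ... | true  = cong (λ b → not b ∧ true ∨ w == parent x)
                     (≢⇒==-false {i = w} (x≢root ∘ trans (sym (==⇒≡ {j = x} w==x))))
  ... | false = cong (_∨ w == parent x) (∧-zeroʳ (not (w == root)))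

  child-subdivide-old : ∀ a b → child subdivide (suc a) (suc b) ≡ child T a b ∧ not (a == x)
  child-subdivide-old a b with a == x
  ... | true  rewrite ∧-zeroʳ (child T a b) = ∧-zeroʳ (not (a == root))
  ... | false = sym (∧-identityʳ (child T a b))

  child-x : ∀ b → child T x b ≡ (b == parent x)
  child-x b = cong (λ c → not c ∧ b == parent x) (≢⇒==-false x≢root)

  parent-not-child-x : child T (parent x) x ≡ false
  parent-not-child-x = child-asym T {x} {parent x} (child-parent T x x≢root)

  child-unless-onEdge : ∀ a b →
    (child T a b ∧ not (a == x) ∨ child T b a ∧ not (b == x)) ≡ (edge T a b ∧ not (onEdge a b))
  child-unless-onEdge a b =
    truthTable (a == x) (b == x) (a == parent x) (b == parent x) (child T a b) (child T b a)
      (child-from-x a b) (child-from-x b a) (into-x a b) (into-x b a) (x≢parent a) (x≢parent b)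
    where
    child-from-x : ∀ u v → (u == x) ≡ true → child T u v ≡ (v == parent x)
    child-from-x u v u==x = subst (λ k → child T k v ≡ (v == parent x)) (sym (==⇒≡ {i = u} u==x)) (child-x v)
    into-x : ∀ u v → (u == x) ≡ true → (v == parent x) ≡ true → child T v u ≡ false
    into-x u v u==x v==y =
      subst₂ (λ k l → child T l k ≡ false) (sym (==⇒≡ {i = u} u==x)) (sym (==⇒≡ {i = v} v==y))
        parent-not-child-x
    x≢parent : ∀ u → (u == x) ≡ true → (u == parent x) ≡ false
    x≢parent u u==x = ≢⇒==-false {i = u} (parent≢ T x x≢root ∘ sym ∘ trans (sym (==⇒≡ {i = u} u==x)))
    truthTable : ∀ A B Yₐ Y_b P Q → (A ≡ true → P ≡ Y_b) → (B ≡ true → Q ≡ Yₐ) →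
      (A ≡ true → Y_b ≡ true → Q ≡ false) → (B ≡ true → Yₐ ≡ true → P ≡ false) →
      (A ≡ true → Yₐ ≡ false) → (B ≡ true → Y_b ≡ false) →
      (P ∧ not A ∨ Q ∧ not B) ≡ ((P ∨ Q) ∧ not (A ∧ Y_b ∨ Yₐ ∧ B))
    truthTable true true Yₐ Y_b P Q P≡ Q≡ _ _ Yₐ≡ Y_b≡
      rewrite P≡ refl | Q≡ refl | Yₐ≡ refl | Y_b≡ refl = refl
    truthTable true false Yₐ true P Q P≡ _ Q≡ _ Yₐ≡ _ rewrite P≡ refl | Q≡ refl refl = refl
    truthTable true false Yₐ false P Q P≡ _ _ _ Yₐ≡ _ rewrite P≡ refl | Yₐ≡ refl = refl
    truthTable false true true Y_b P Q _ Q≡ _ P≡ _ Y_b≡ rewrite Q≡ refl | P≡ refl refl = refl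
    truthTable false true false Y_b P Q _ Q≡ _ _ _ _
      rewrite Q≡ refl | ∧-identityʳ P | ∨-identityʳ P | ∧-identityʳ P = refl
    truthTable false false Yₐ Y_b P Q _ _ _ _ _ _
      rewrite ∧-zeroʳ Yₐ | ∧-identityʳ P | ∧-identityʳ Q | ∧-identityʳ (P ∨ Q) = refl

  edge-subdivide-old : ∀ a b → edge subdivide (suc a) (suc b) ≡ edge T a b ∧ not (onEdge a b)
  edge-subdivide-old a b =
    trans (cong₂ _∨_ (child-subdivide-old a b) (child-subdivide-old b a)) (child-unless-onEdge a b)

  parent-subdivide-x : ParentTree.parent subdivide (suc x) ≡ zero
  parent-subdivide-x with x == x | ==-refl x
  ... | .true | refl = refl

  parent-subdivide-other : ∀ {u} → u ≢ x → ParentTree.parent subdivide (suc u) ≡ suc (parent u)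
  parent-subdivide-other {u} u≢x with u == x | ≢⇒==-false u≢x
  ... | .false | refl = refl

  onEdge-cases : ∀ {a b} → onEdge a b ≡ true → (a ≡ x × b ≡ parent x) ⊎ (a ≡ parent x × b ≡ x)
  onEdge-cases {a} {b} on with ∨-true (a == x ∧ b == parent x) (a == parent x ∧ b == x) on
  ... | inj₁ xy = let (a==x , b==y) = ∧-true (a == x) _ xy in inj₁ (==⇒≡ a==x , ==⇒≡ b==y)
  ... | inj₂ yx = let (a==y , b==x) = ∧-true (a == parent x) _ yx in inj₂ (==⇒≡ a==y , ==⇒≡ b==x)

  count-onEdge : ∀ w → count (onEdge w) ≡ bit (w == x ∨ w == parent x)
  count-onEdge w with w ≟ x
  ... | yes refl rewrite ≢⇒==-false (parent≢ T w x≢root ∘ sym) =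
    trans (sum-cong-≗ (λ u → cong bit (∨-identityʳ (u == parent w)))) (count-== (parent w))
  ... | no w≢x with w ≟ parent x
  ...   | yes refl = count-== x
  ...   | no w≢y = count-false {n} _ (λ _ → refl)

SameEdge : ∀ {n} → Fin n → Fin n → Fin n → Fin n → Set
SameEdge i j a b = (i ≡ a × j ≡ b) ⊎ (i ≡ b × j ≡ a)

module _ {n k} (f : Fin n → Fin k) where

  SameEdge-map : ∀ {i j a b} → SameEdge i j a b → SameEdge (f i) (f j) (f a) (f b)
  SameEdge-map = ⊎.map (×.map (cong f) (cong f)) (×.map (cong f) (cong f))

  C4Edge-map : ∀ {a b c e i j} → C4Edge a b c e i j → C4Edge (f a) (f b) (f c) (f e) (f i) (f j)
  C4Edge-map = ⊎.map SameEdge-map (⊎.map SameEdge-map (⊎.map SameEdge-map SameEdge-map))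

  module _ (f-injective : ∀ {i j} → f i ≡ f j → i ≡ j) where

    SameEdge-unmap : ∀ {i j a b} → SameEdge (f i) (f j) (f a) (f b) → SameEdge i j a b
    SameEdge-unmap = ⊎.map (×.map f-injective f-injective) (×.map f-injective f-injective)

    C4Edge-unmap : ∀ {a b c e i j} → C4Edge (f a) (f b) (f c) (f e) (f i) (f j) → C4Edge a b c e i j
    C4Edge-unmap = ⊎.map SameEdge-unmap (⊎.map SameEdge-unmap (⊎.map SameEdge-unmap SameEdge-unmap))

SameEdge-sym : ∀ {n} {i j a b : Fin n} → SameEdge i j a b → SameEdge j i a b
SameEdge-sym = ⊎.swap ∘ ⊎.map ×.swap ×.swap

C4Edge-sym : ∀ {n} {a b c e i j : Fin n} → C4Edge a b c e i j → C4Edge a b c e j i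
C4Edge-sym = ⊎.map SameEdge-sym (⊎.map SameEdge-sym (⊎.map SameEdge-sym SameEdge-sym))

¬C4Edge-zero : ∀ {n} {a b c e : Fin n} {i} → ¬ C4Edge (suc a) (suc b) (suc c) (suc e) i zero
¬C4Edge-zero = ⊎.[ ¬SameEdge-zero , ⊎.[ ¬SameEdge-zero , ⊎.[ ¬SameEdge-zero , ¬SameEdge-zero ] ] ]
  where
  ¬SameEdge-zero : ∀ {n} {i} {a b : Fin n} → ¬ SameEdge i zero (suc a) (suc b)
  ¬SameEdge-zero (inj₁ (_ , ()))
  ¬SameEdge-zero (inj₂ (_ , ()))

SameEdge? : ∀ {n} (i j a b : Fin n) → Dec (SameEdge i j a b)
SameEdge? i j a b = (i ≟ a ×-dec j ≟ b) ⊎-dec (i ≟ b ×-dec j ≟ a)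

C4Edge? : ∀ {n} (a b c e i j : Fin n) → Dec (C4Edge a b c e i j)
C4Edge? a b c e i j = SameEdge? i j a b ⊎-dec SameEdge? i j b c ⊎-dec SameEdge? i j c e ⊎-dec SameEdge? i j e a

record C4PivotRealization (n : ℕ) (deg : Fin n → ℕ) : Set where
  field
    T₁ T₂ : ParentTree n

  union : Graph n
  union = treeGraph T₁ ∪ᴳ treeGraph T₂

  shared : Graph n
  shared = treeGraph T₁ ∩ᴳ treeGraph T₂

  field
    realizes        : Realizes union deg
    c₁ c₂ c₃ c₄     : Fin n
    inducedC4       : InducedC4 union c₁ c₂ c₃ c₄
    shared⊆C4       : ∀ i j → Adj shared i j → C4Edge c₁ c₂ c₃ c₄ i j
    -- by the handshake lemma, the trees share exactly two edges
    ∑-degree-shared : ∑ (degree shared) ≡ 4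

realization-cong : ∀ {n} {f g : Fin n → ℕ} → C4PivotRealization n f → (∀ i → f i ≡ g i) → C4PivotRealization n g
realization-cong R f≗g = record
  { T₁ = T₁ ; T₂ = T₂ ; realizes = λ i → trans (realizes i) (f≗g i)
  ; c₁ = c₁ ; c₂ = c₂ ; c₃ = c₃ ; c₄ = c₄ ; inducedC4 = inducedC4
  ; shared⊆C4 = shared⊆C4 ; ∑-degree-shared = ∑-degree-shared
  }
  where open C4PivotRealization R

relabel : ∀ {n deg} (π : Permutation′ n) → C4PivotRealization n deg → C4PivotRealization n (deg ∘ (π ⟨$⟩ʳ_))
relabel {n} π R = record
  { T₁              = relabelTree π T₁
  ; T₂              = relabelTree π T₂
  ; realizes        = λ i → trans (degree-relabel (treeGraph T₁′ ∪ᴳ treeGraph T₂′) union union′≈ i)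
                                   (realizes (π ⟨$⟩ʳ i))
  ; c₁              = π ⟨$⟩ˡ c₁
  ; c₂              = π ⟨$⟩ˡ c₂
  ; c₃              = π ⟨$⟩ˡ c₃
  ; c₄              = π ⟨$⟩ˡ c₄
  ; inducedC4       = relabel-inducedC4 inducedC4
  ; shared⊆C4       = λ i j sh → subst₂ (C4Edge _ _ _ _) (inverseˡ π) (inverseˡ π)
                        (C4Edge-map (π ⟨$⟩ˡ_) (shared⊆C4 _ _ (trans (sym (shared′≈ i j)) sh)))
  ; ∑-degree-shared = trans (sum-cong-≗ (degree-relabel (treeGraph T₁′ ∩ᴳ treeGraph T₂′) shared shared′≈))
                        (trans (sym (sum-permute (degree shared) π)) ∑-degree-shared)
  }
  where
  open C4PivotRealization R
  T₁′ T₂′ : ParentTree n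
  T₁′ = relabelTree π T₁
  T₂′ = relabelTree π T₂

  union′≈ : treeGraph T₁′ ∪ᴳ treeGraph T₂′ ≈ᴳ relabelGraph π union
  union′≈ i j = cong₂ _∨_ (edge-relabelTree π T₁ i j) (edge-relabelTree π T₂ i j)

  shared′≈ : treeGraph T₁′ ∩ᴳ treeGraph T₂′ ≈ᴳ relabelGraph π shared
  shared′≈ i j = cong₂ _∧_ (edge-relabelTree π T₁ i j) (edge-relabelTree π T₂ i j)

  degree-relabel : ∀ G H → G ≈ᴳ relabelGraph π H → ∀ i → degree G i ≡ degree H (π ⟨$⟩ʳ i)
  degree-relabel G H G≈ i = trans (degree-cong {G = G} {H = relabelGraph π H} G≈ i) (degree-relabelGraph π H i)

  ⟨$⟩ˡ-injective : ∀ {a b} → π ⟨$⟩ˡ a ≡ π ⟨$⟩ˡ b → a ≡ b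
  ⟨$⟩ˡ-injective {a} {b} eq = trans (sym (inverseʳ π)) (trans (cong (π ⟨$⟩ʳ_) eq) (inverseʳ π))

  union-back : ∀ {a b} {v : Bool} → adj union a b ≡ v →
    adj (treeGraph T₁′ ∪ᴳ treeGraph T₂′) (π ⟨$⟩ˡ a) (π ⟨$⟩ˡ b) ≡ v
  union-back {a} {b} ab =
    trans (union′≈ _ _) (subst₂ (λ k l → adj union k l ≡ _) (sym (inverseʳ π)) (sym (inverseʳ π)) ab)

  relabel-inducedC4 : ∀ {a b c e} → InducedC4 union a b c e →
    InducedC4 (treeGraph T₁′ ∪ᴳ treeGraph T₂′) (π ⟨$⟩ˡ a) (π ⟨$⟩ˡ b) (π ⟨$⟩ˡ c) (π ⟨$⟩ˡ e)
  relabel-inducedC4 (unique , ab , bc , ce , ea , ¬ac , ¬be) =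
    Unique.map⁺ ⟨$⟩ˡ-injective unique ,
    union-back ab , union-back bc , union-back ce , union-back ea , union-back ¬ac , union-back ¬be

4m∸4≡2*[2[1+m]∸4] : ∀ m → 4 * m ∸ 4 ≡ 2 * (2 * suc m ∸ 4)
4m∸4≡2*[2[1+m]∸4] m = begin
  4 * m ∸ 4              ≡⟨ cong (_∸ 8) (*-suc 4 m) ⟨
  4 * suc m ∸ 8          ≡⟨ cong (_∸ 8) (*-assoc 2 2 (suc m)) ⟩
  2 * (2 * suc m) ∸ 2 * 4 ≡⟨ *-distribˡ-∸ 2 (2 * suc m) 4 ⟨
  2 * (2 * suc m ∸ 4)    ∎
  where open ≡-Reasoning

realization-C4Pivotable : ∀ {m deg} (R : C4PivotRealization (suc m) deg) → ∑ deg ≡ 4 * m ∸ 4 →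
  C4Pivotable (C4PivotRealization.union R)
realization-C4Pivotable {m} {deg} R ∑deg≡ =
  edgeCount-union , c₁ , c₂ , c₃ , c₄ , inducedC4 , treeGraph T₁ , treeGraph T₂ ,
  treeGraph-spanningTree T₁ {union} (λ i j e → ∨-trueˡ _ e) ,
  treeGraph-spanningTree T₂ {union} (λ i j e → ∨-trueʳ (edge T₁ i j) e) ,
  edgeCount-shared , shared⊆C4
  where
  open C4PivotRealization R
  edgeCount-union : edgeCount union ≡ 2 * suc m ∸ 4
  edgeCount-union = *-cancelˡ-≡ _ _ 2 (begin
    2 * edgeCount union       ≡⟨ handshake union ⟨
    ∑ (degree union)          ≡⟨ sum-cong-≗ realizes ⟩
    ∑ deg                     ≡⟨ ∑deg≡ ⟩
    4 * m ∸ 4                 ≡⟨ 4m∸4≡2*[2[1+m]∸4] m ⟩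
    2 * (2 * suc m ∸ 4)       ∎)
    where open ≡-Reasoning
  edgeCount-shared : edgeCount shared ≡ 2
  edgeCount-shared = *-cancelˡ-≡ _ 2 2 (trans (sym (handshake shared)) ∑-degree-shared)

-- Edge splits

module _ {n deg} (R : C4PivotRealization n deg) where
  open C4PivotRealization R
  open ParentTree T₁

  -- A T₁-edge is named by its child endpoint x: it is the edge from x to its parent.
  FreeEdge : Fin n → Set
  FreeEdge x = x ≢ root × edge T₂ x (parent x) ≡ false × ¬ C4Edge c₁ c₂ c₃ c₄ x (parent x)

  DisjointEdges : Fin n → Fin n → Set
  DisjointEdges x x′ = x ≢ x′ × x ≢ parent x′ × parent x ≢ x′ × parent x ≢ parent x′

  DisjointEdges-sym : ∀ {x x′} → DisjointEdges x x′ → DisjointEdges x′ x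
  DisjointEdges-sym (x≢x′ , x≢px′ , px≢x′ , px≢px′) = x≢x′ ∘ sym , px≢x′ ∘ sym , x≢px′ ∘ sym , px≢px′ ∘ sym

record Splittable (n : ℕ) (deg : Fin n → ℕ) : Set where
  field
    realization : C4PivotRealization n deg
    s₁ s₂       : Fin n
    s₁-free     : FreeEdge realization s₁
    s₂-free     : FreeEdge realization s₂
    disjoint    : DisjointEdges realization s₁ s₂

splittable-cong : ∀ {n} {f g : Fin n → ℕ} → Splittable n f → (∀ i → f i ≡ g i) → Splittable n g
splittable-cong S f≗g = record
  { realization = realization-cong realization f≗g
  ; s₁ = s₁ ; s₂ = s₂ ; s₁-free = s₁-free ; s₂-free = s₂-free ; disjoint = disjoint
  }
  where open Splittable S

splitDegrees : ∀ {m} → (Fin m → ℕ) → Fin m → Fin (suc m) → ℕ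
splitDegrees deg z zero    = 3
splitDegrees deg z (suc u) = deg u + bit (u == z)

module EdgeSplit {m deg} (R : C4PivotRealization m deg) (z x : Fin m) (x-free : FreeEdge R x)
                 (z≢x : z ≢ x) (z≢y : z ≢ ParentTree.parent (C4PivotRealization.T₁ R) x) where
  open C4PivotRealization R
  open ParentTree T₁ using (root; parent)

  x≢root : x ≢ root
  x≢root = proj₁ x-free

  y : Fin m
  y = parent x

  onXY : Fin m → Fin m → Bool
  onXY = onEdge T₁ x x≢root

  T₁⁺ T₂⁺ : ParentTree (suc m)
  T₁⁺ = subdivide T₁ x x≢root
  T₂⁺ = attachLeaf T₂ z

  union⁺ shared⁺ : Graph (suc m)
  union⁺  = treeGraph T₁⁺ ∪ᴳ treeGraph T₂⁺
  shared⁺ = treeGraph T₁⁺ ∩ᴳ treeGraph T₂⁺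

  onXY⇒∉T₂ : ∀ a b → onXY a b ≡ true → edge T₂ a b ≡ false
  onXY⇒∉T₂ a b on with onEdge-cases T₁ x x≢root {a} {b} on
  ... | inj₁ (refl , refl) = proj₁ (proj₂ x-free)
  ... | inj₂ (refl , refl) = trans (Graph.sym (treeGraph T₂) y x) (proj₁ (proj₂ x-free))

  onXY⇒union : ∀ a b → onXY a b ≡ true → adj union a b ≡ true
  onXY⇒union a b on with onEdge-cases T₁ x x≢root {a} {b} on
  ... | inj₁ (refl , refl) = ∨-trueˡ _ (edge-parent T₁ x x≢root)
  ... | inj₂ (refl , refl) = trans (Graph.sym union y x) (∨-trueˡ _ (edge-parent T₁ x x≢root))

  xy∌z : ∀ w → ((w == x ∨ w == y) ∧ w == z) ≡ false
  xy∌z w with w ≟ z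
  ... | yes refl rewrite ≢⇒==-false z≢x | ≢⇒==-false z≢y = refl
  ... | no w≢z = ∧-zeroʳ (w == x ∨ w == y)

  union⁺-new : ∀ w → adj union⁺ (suc w) zero ≡ (w == x ∨ w == y) ∨ w == z
  union⁺-new w = cong₂ _∨_ (edge-subdivide-new T₁ x x≢root w) (edge-attachLeaf-new T₂ z w)

  union⁺-old : ∀ a b → adj union⁺ (suc a) (suc b) ≡ adj union a b ∧ not (onXY a b)
  union⁺-old a b = trans (cong (_∨ edge T₂ a b) (edge-subdivide-old T₁ x x≢root a b))
                         (remove (edge T₁ a b) (edge T₂ a b) (onXY a b) (onXY⇒∉T₂ a b))
    where
    remove : ∀ e₁ e₂ s → (s ≡ true → e₂ ≡ false) → (e₁ ∧ not s ∨ e₂) ≡ ((e₁ ∨ e₂) ∧ not s)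
    remove e₁ e₂ true  s⇒¬e₂ rewrite s⇒¬e₂ refl | ∧-zeroʳ e₁ | ∧-zeroʳ (e₁ ∨ false) = refl
    remove e₁ e₂ false _     rewrite ∧-identityʳ e₁ | ∧-identityʳ (e₁ ∨ e₂) = refl

  shared⁺-new : ∀ w → adj shared⁺ (suc w) zero ≡ false
  shared⁺-new w = trans (cong₂ _∧_ (edge-subdivide-new T₁ x x≢root w) (edge-attachLeaf-new T₂ z w)) (xy∌z w)

  shared⁺-old : ∀ a b → adj shared⁺ (suc a) (suc b) ≡ adj shared a b
  shared⁺-old a b = trans (cong (_∧ edge T₂ a b) (edge-subdivide-old T₁ x x≢root a b))
                          (remove (edge T₁ a b) (edge T₂ a b) (onXY a b) (onXY⇒∉T₂ a b))
    where
    remove : ∀ e₁ e₂ s → (s ≡ true → e₂ ≡ false) → ((e₁ ∧ not s) ∧ e₂) ≡ (e₁ ∧ e₂)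
    remove e₁ e₂ true  s⇒¬e₂ rewrite s⇒¬e₂ refl | ∧-zeroʳ e₁ = refl
    remove e₁ e₂ false _     rewrite ∧-identityʳ e₁ = refl

  degree⁺-old : ∀ w → degree union⁺ (suc w) ≡ deg w + bit (w == z)
  degree⁺-old w = begin
    degree union⁺ (suc w)
      ≡⟨ degree≡count union⁺ (suc w) ⟩
    bit (adj union⁺ (suc w) zero) + count (λ u → adj union⁺ (suc w) (suc u))
      ≡⟨ cong₂ _+_ (cong bit (union⁺-new w)) (sum-cong-≗ (cong bit ∘ union⁺-old w)) ⟩
    bit ((w == x ∨ w == y) ∨ w == z) + C
      ≡⟨ cong (_+ C) (bit-∨ (w == x ∨ w == y) (w == z) (xy∌z w)) ⟩
    bit (w == x ∨ w == y) + bit (w == z) + C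
      ≡⟨ trans (+-comm _ C) (sym (+-assoc C _ _)) ⟩
    C + bit (w == x ∨ w == y) + bit (w == z)
      ≡⟨ cong (λ k → C + k + bit (w == z)) (count-onEdge T₁ x x≢root w) ⟨
    C + count (onXY w) + bit (w == z)
      ≡⟨ cong (_+ bit (w == z)) (count-split (adj union w) (onXY w) (onXY⇒union w)) ⟨
    count (adj union w) + bit (w == z)
      ≡⟨ cong (_+ bit (w == z)) (trans (sym (degree≡count union w)) (realizes w)) ⟩
    deg w + bit (w == z) ∎
    where
    open ≡-Reasoning
    C : ℕ
    C = count (λ u → adj union w u ∧ not (onXY w u))

  degree⁺-new : degree union⁺ zero ≡ 3
  degree⁺-new = begin
    degree union⁺ zero
      ≡⟨ degree≡count union⁺ zero ⟩
    count (λ u → adj union⁺ zero (suc u))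
      ≡⟨ sum-cong-≗ (λ u → cong bit (trans (Graph.sym union⁺ zero (suc u)) (union⁺-new u))) ⟩
    count (λ u → (u == x ∨ u == y) ∨ u == z)
      ≡⟨ count-∨ (λ u → u == x ∨ u == y) (_== z) xy∌z ⟩
    count (λ u → u == x ∨ u == y) + count (_== z)
      ≡⟨ cong (_+ count (_== z)) (count-∨ (_== x) (_== y) x∌y) ⟩
    count (_== x) + count (_== y) + count (_== z)
      ≡⟨ cong₂ _+_ (cong₂ _+_ (count-== x) (count-== y)) (count-== z) ⟩
    3 ∎
    where
    open ≡-Reasoning
    x∌y : ∀ u → (u == x ∧ u == y) ≡ false
    x∌y u with u ≟ x
    ... | yes refl = ≢⇒==-false (parent≢ T₁ u x≢root ∘ sym)
    ... | no _     = refl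

  realizes⁺ : Realizes union⁺ (splitDegrees deg z)
  realizes⁺ zero    = degree⁺-new
  realizes⁺ (suc w) = degree⁺-old w

  onXY-∉C4 : ∀ a b → C4Edge c₁ c₂ c₃ c₄ a b → onXY a b ≡ false
  onXY-∉C4 a b c with onXY a b in on
  ... | false = refl
  ... | true with onEdge-cases T₁ x x≢root {a} {b} on
  ...   | inj₁ (refl , refl) = contradiction c (proj₂ (proj₂ x-free))
  ...   | inj₂ (refl , refl) = contradiction (C4Edge-sym c) (proj₂ (proj₂ x-free))

  inducedC4⁺ : InducedC4 union⁺ (suc c₁) (suc c₂) (suc c₃) (suc c₄)
  inducedC4⁺ with inducedC4
  ... | unique , e₁₂ , e₂₃ , e₃₄ , e₄₁ , ¬e₁₃ , ¬e₂₄ =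
    Unique.map⁺ suc-injective unique ,
    keep (inj₁ (inj₁ (refl , refl))) e₁₂ ,
    keep (inj₂ (inj₁ (inj₁ (refl , refl)))) e₂₃ ,
    keep (inj₂ (inj₂ (inj₁ (inj₁ (refl , refl))))) e₃₄ ,
    keep (inj₂ (inj₂ (inj₂ (inj₁ (refl , refl))))) e₄₁ ,
    trans (union⁺-old c₁ c₃) (cong (_∧ not (onXY c₁ c₃)) ¬e₁₃) ,
    trans (union⁺-old c₂ c₄) (cong (_∧ not (onXY c₂ c₄)) ¬e₂₄)
    where
    keep : ∀ {a b} → C4Edge c₁ c₂ c₃ c₄ a b → Adj union a b → Adj union⁺ (suc a) (suc b)
    keep {a} {b} c e rewrite union⁺-old a b | onXY-∉C4 a b c | e = refl

  shared⊆C4⁺ : ∀ i j → Adj shared⁺ i j → C4Edge (suc c₁) (suc c₂) (suc c₃) (suc c₄) i j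
  shared⊆C4⁺ zero    zero    ()
  shared⊆C4⁺ zero    (suc u) sh =
    contradiction (trans (sym (shared⁺-new u)) (trans (Graph.sym shared⁺ (suc u) zero) sh)) λ ()
  shared⊆C4⁺ (suc w) zero    sh = contradiction (trans (sym (shared⁺-new w)) sh) λ ()
  shared⊆C4⁺ (suc a) (suc b) sh = C4Edge-map suc (shared⊆C4 a b (trans (sym (shared⁺-old a b)) sh))

  ∑-degree-shared⁺ : ∑ (degree shared⁺) ≡ 4
  ∑-degree-shared⁺ = trans (cong₂ _+_ degree-new (sum-cong-≗ degree-old)) ∑-degree-shared
    where
    degree-new : degree shared⁺ zero ≡ 0
    degree-new = trans (degree≡count shared⁺ zero) (count-false (adj shared⁺ zero) λ
      { zero    → irrefl shared⁺ zero
      ; (suc u) → trans (Graph.sym shared⁺ zero (suc u)) (shared⁺-new u) })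
    degree-old : ∀ w → degree shared⁺ (suc w) ≡ degree shared w
    degree-old w = trans (degree≡count shared⁺ (suc w))
      (trans (cong₂ _+_ (cong bit (shared⁺-new w)) (sum-cong-≗ (cong bit ∘ shared⁺-old w)))
             (sym (degree≡count shared w)))

  realization⁺ : C4PivotRealization (suc m) (splitDegrees deg z)
  realization⁺ = record
    { T₁ = T₁⁺ ; T₂ = T₂⁺ ; realizes = realizes⁺
    ; c₁ = suc c₁ ; c₂ = suc c₂ ; c₃ = suc c₃ ; c₄ = suc c₄ ; inducedC4 = inducedC4⁺
    ; shared⊆C4 = shared⊆C4⁺ ; ∑-degree-shared = ∑-degree-shared⁺
    }

  splittable⁺ : ∀ x′ → FreeEdge R x′ → DisjointEdges R x x′ → Splittable (suc m) (splitDegrees deg z)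
  splittable⁺ x′ (x′≢root , x′∉T₂ , x′∉C4) (x≢x′ , x≢px′ , _ , _) = record
    { realization = realization⁺
    ; s₁          = suc x
    ; s₂          = suc x′
    ; s₁-free     = x≢root ∘ suc-injective
                  , subst (λ k → edge T₂⁺ (suc x) k ≡ false) (sym parent⁺-x)
                      (trans (edge-attachLeaf-new T₂ z x) (≢⇒==-false (z≢x ∘ sym)))
                  , ¬C4Edge-zero ∘ subst (C4Edge _ _ _ _ (suc x)) parent⁺-x
    ; s₂-free     = x′≢root ∘ suc-injective
                  , subst (λ k → edge T₂⁺ (suc x′) k ≡ false) (sym parent⁺-x′) x′∉T₂
                  , x′∉C4 ∘ C4Edge-unmap suc suc-injective ∘ subst (C4Edge _ _ _ _ (suc x′)) parent⁺-x′
    ; disjoint    = x≢x′ ∘ suc-injective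
                  , x≢px′ ∘ suc-injective ∘ (λ e → trans e parent⁺-x′)
                  , (λ ()) ∘ trans (sym parent⁺-x)
                  , (λ ()) ∘ trans (sym parent⁺-x) ∘ (λ e → trans e parent⁺-x′)
    }
    where
    parent⁺-x : ParentTree.parent T₁⁺ (suc x) ≡ zero
    parent⁺-x = parent-subdivide-x T₁ x x≢root
    parent⁺-x′ : ParentTree.parent T₁⁺ (suc x′) ≡ suc (parent x′)
    parent⁺-x′ = parent-subdivide-other T₁ x x≢root (x≢x′ ∘ sym)

splittable-split : ∀ {m deg} → Splittable m deg → ∀ z → Splittable (suc m) (splitDegrees deg z)
splittable-split {deg = deg} S z = choose (z ≟ s₁) (z ≟ parent s₁)
  where
  open Splittable S
  open ParentTree (C4PivotRealization.T₁ realization) using (parent)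
  choose : Dec (z ≡ s₁) → Dec (z ≡ parent s₁) → Splittable _ (splitDegrees deg z)
  choose (no z≢s₁) (no z≢ps₁) = EdgeSplit.splittable⁺ realization z s₁ s₁-free z≢s₁ z≢ps₁ s₂ s₂-free disjoint
  choose (yes z≡s₁) _ with disjoint
  ... | s₁≢s₂ , s₁≢ps₂ , _ = EdgeSplit.splittable⁺ realization z s₂ s₂-free
          (s₁≢s₂ ∘ trans (sym z≡s₁)) (s₁≢ps₂ ∘ trans (sym z≡s₁))
          s₁ s₁-free (DisjointEdges-sym realization disjoint)
  choose (no _) (yes z≡ps₁) with disjoint
  ... | _ , _ , ps₁≢s₂ , ps₁≢ps₂ = EdgeSplit.splittable⁺ realization z s₂ s₂-free
          (ps₁≢s₂ ∘ trans (sym z≡ps₁)) (ps₁≢ps₂ ∘ trans (sym z≡ps₁))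
          s₁ s₁-free (DisjointEdges-sym realization disjoint)

baseDegrees : Fin 10 → ℕ
baseDegrees i = if i == fromℕ 9 then 5 else 3

-- Ten vertices: the base case

module _ (parents : Vec (Fin 10) 10) (heights : Vec ℕ 10) where

  parentLower? : Dec (∀ x → x ≢ zero → Vec.lookup heights (Vec.lookup parents x) < Vec.lookup heights x)
  parentLower? = all? λ x → ¬? (x ≟ zero) →-dec Vec.lookup heights (Vec.lookup parents x) ℕ.<? Vec.lookup heights x

  baseTree : True parentLower? → ParentTree 10
  baseTree lower = record
    { root         = zero
    ; parent       = Vec.lookup parents
    ; height       = Vec.lookup heights
    ; parent-lower = toWitness lower
    }

baseRealization : C4PivotRealization 10 baseDegrees
baseRealization = record
  { T₁              = T₁
  ; T₂              = T₂
  ; realizes        = from-yes (all? λ i → degree union i ℕ.≟ baseDegrees i)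
  ; c₁              = # 0
  ; c₂              = # 1
  ; c₃              = # 5
  ; c₄              = # 9
  ; inducedC4       = from-yes (unique? c₁c₂c₃c₄) , refl , refl , refl , refl , refl , refl
  ; shared⊆C4       = from-yes (all? λ i → all? λ j →
                        adj shared i j Bool.≟ true →-dec C4Edge? (# 0) (# 1) (# 5) (# 9) i j)
  ; ∑-degree-shared = refl
  }
  where
  T₁ T₂ : ParentTree 10
  T₁ = baseTree (# 0 ∷ # 0 ∷ # 9 ∷ # 4 ∷ # 2 ∷ # 1 ∷ # 5 ∷ # 3 ∷ # 1 ∷ # 0 ∷ [])
                (0 ∷ 1 ∷ 2 ∷ 4 ∷ 3 ∷ 2 ∷ 3 ∷ 5 ∷ 2 ∷ 1 ∷ []) _
  T₂ = baseTree (# 0 ∷ # 0 ∷ # 0 ∷ # 9 ∷ # 6 ∷ # 1 ∷ # 7 ∷ # 8 ∷ # 9 ∷ # 5 ∷ [])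
                (0 ∷ 1 ∷ 1 ∷ 4 ∷ 7 ∷ 2 ∷ 6 ∷ 5 ∷ 4 ∷ 3 ∷ []) _
  open UniqueDec (_≟_ {10}) using (unique?)
  c₁c₂c₃c₄ : List (Fin 10)
  c₁c₂c₃c₄ = # 0 ∷ # 1 ∷ # 5 ∷ # 9 ∷ []
  union shared : Graph 10
  union  = treeGraph T₁ ∪ᴳ treeGraph T₂
  shared = treeGraph T₁ ∩ᴳ treeGraph T₂

baseSplittable : Splittable 10 baseDegrees
baseSplittable = record
  { realization = baseRealization
  ; s₁          = # 4
  ; s₂          = # 7
  ; s₁-free     = (λ ()) , refl , from-no (C4Edge? {10} (# 0) (# 1) (# 5) (# 9) (# 4) (# 2))
  ; s₂-free     = (λ ()) , refl , from-no (C4Edge? {10} (# 0) (# 1) (# 5) (# 9) (# 7) (# 3))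
  ; disjoint    = (λ ()) , (λ ()) , (λ ()) , (λ ())
  }

NonDecreasing : ∀ {n} → (Fin n → ℕ) → Set
NonDecreasing {n} e = ∀ (i j : Fin n) → i ≤ᶠ j → e i ≤ e j

record Admissible (m : ℕ) (e : Fin (suc m) → ℕ) : Set where
  field
    nonDecreasing : NonDecreasing e
    first≡3       : e zero ≡ 3
    5≤last        : 5 ≤ e (fromℕ m)
    ∑≡4m∸4        : ∑ e ≡ 4 * m ∸ 4

  3≤ : ∀ i → 3 ≤ e i
  3≤ i = subst (_≤ e i) first≡3 (nonDecreasing zero i z≤n)

4[1+m]∸4≡4m : ∀ m → 4 * suc m ∸ 4 ≡ 4 * m
4[1+m]∸4≡4m m = trans (cong (_∸ 4) (*-suc 4 m)) (m+n∸m≡n 4 (4 * m))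

admissible⇒9≤m : ∀ {m e} → Admissible m e → 9 ≤ m
admissible⇒9≤m {zero}  adm = contradiction (subst (5 ≤_) first≡3 5≤last) (from-no (5 ℕ.≤? 3))
  where open Admissible adm
admissible⇒9≤m {suc k} {e} adm = s≤s (+-cancelˡ-≤ (3 * k) 8 k (begin
  3 * k + 8                      ≡⟨ 3k+8≡[1+k]3+5 k ⟩
  suc k * 3 + 5                  ≤⟨ +-mono-≤ (*≤∑ 3 (e ∘ inject₁) (3≤ ∘ inject₁)) 5≤last ⟩
  ∑ (e ∘ inject₁) + e (fromℕ (suc k)) ≡⟨ sum-init-last e ⟨
  ∑ e                            ≡⟨ trans ∑≡4m∸4 (4[1+m]∸4≡4m k) ⟩
  4 * k                          ≡⟨ +-comm k (3 * k) ⟩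
  3 * k + k                      ∎))
  where
  open Admissible adm
  open ≤-Reasoning
  3k+8≡[1+k]3+5 : ∀ k → 3 * k + 8 ≡ suc k * 3 + 5
  3k+8≡[1+k]3+5 = solve-∀

bit≤1 : ∀ b → bit b ≤ 1
bit≤1 true  = ≤-refl
bit≤1 false = z≤n

-- Removing the leading 3 and lowering the first entry ≥ 4 undoes an edge split.
module Unsplit {M} {e : Fin (suc (suc M)) → ℕ} (adm : Admissible (suc M) e) (9≤M : 9 ≤ M) where
  open Admissible adm

  ∑≡4M : ∑ e ≡ 4 * M
  ∑≡4M = trans ∑≡4m∸4 (4[1+m]∸4≡4m M)

  second≡3 : e (suc zero) ≡ 3
  second≡3 with 4 ℕ.≤? e (suc zero)
  ... | no  4≰e₁ = ≤-antisym (≤-pred (≰⇒> 4≰e₁)) (3≤ (suc zero))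
  ... | yes 4≤e₁ = contradiction ∑≡4M (>⇒≢ (begin-strict
    4 * M                 <⟨ m≤m+n (suc (4 * M)) 6 ⟩
    suc (4 * M) + 6       ≡⟨ 4M+7≡3+[1+M]4 M ⟩
    3 + suc M * 4         ≤⟨ +-mono-≤ (3≤ zero) (*≤∑ 4 (e ∘ suc) 4≤e[1+u]) ⟩
    ∑ e                   ∎))
    where
    open ≤-Reasoning
    4≤e[1+u] : ∀ u → 4 ≤ e (suc u)
    4≤e[1+u] u = ≤-trans 4≤e₁ (nonDecreasing (suc zero) (suc u) (s≤s z≤n))
    4M+7≡3+[1+M]4 : ∀ M → suc (4 * M) + 6 ≡ 3 + suc M * 4
    4M+7≡3+[1+M]4 = solve-∀

  smallest≥4 : ∃ λ z → ¬ e (suc z) < 4 × (∀ (j : Fin′ z) → e (suc (inject j)) < 4)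
  smallest≥4 = ¬∀⟶∃¬-smallest (suc M) (λ u → e (suc u) < 4) (λ u → e (suc u) ℕ.<? 4)
    (λ all<4 → <⇒≱ (all<4 (fromℕ M)) (≤-trans (n≤1+n 4) 5≤last))

  z : Fin (suc M)
  z = proj₁ smallest≥4

  4≤e[z] : 4 ≤ e (suc z)
  4≤e[z] = ≮⇒≥ (proj₁ (proj₂ smallest≥4))

  before-z : ∀ u → toℕ u < toℕ z → e (suc u) < 4
  before-z u u<z = subst (λ k → e (suc k) < 4) inject-fromℕ< (proj₂ (proj₂ smallest≥4) (fromℕ< u<z))
    where
    inject-fromℕ< : inject (fromℕ< u<z) ≡ u
    inject-fromℕ< = toℕ-injective (trans (toℕ-inject (fromℕ< u<z)) (toℕ-fromℕ< u<z))

  z≢0 : z ≢ zero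
  z≢0 z≡0 = <⇒≱ (subst (_< 4) (sym second≡3) ≤-refl) (subst (λ k → 4 ≤ e (suc k)) z≡0 4≤e[z])

  e′ : Fin (suc M) → ℕ
  e′ u = e (suc u) ∸ bit (u == z)

  splitDegrees-e′≗e : ∀ i → splitDegrees e′ z i ≡ e i
  splitDegrees-e′≗e zero    = sym first≡3
  splitDegrees-e′≗e (suc u) = m∸n+n≡m (≤-trans (bit≤1 (u == z)) (≤-trans (s≤s z≤n) (3≤ (suc u))))

  e′-nonDecreasing : NonDecreasing e′
  e′-nonDecreasing i j i≤j with i == z in i==z | j == z in j==z
  ... | false | false = nonDecreasing (suc i) (suc j) (s≤s i≤j)
  ... | true  | true  = ∸-monoˡ-≤ 1 (nonDecreasing (suc i) (suc j) (s≤s i≤j))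
  ... | true  | false = ≤-trans (m∸n≤m _ 1) (nonDecreasing (suc i) (suc j) (s≤s i≤j))
  ... | false | true  = ≤-trans (≤-pred (before-z i i<z))
                          (∸-monoˡ-≤ 1 (subst (λ k → 4 ≤ e (suc k)) (sym (==⇒≡ j==z)) 4≤e[z]))
    where
    i<z : toℕ i < toℕ z
    i<z = ≤∧≢⇒< (subst (λ k → toℕ i ≤ toℕ k) (==⇒≡ j==z) i≤j) (==-false⇒≢ i==z ∘ toℕ-injective)

  e′-first : e′ zero ≡ 3
  e′-first rewrite ≢⇒==-false (z≢0 ∘ sym) = second≡3

  e′-∑ : ∑ e′ ≡ 4 * M ∸ 4
  e′-∑ = begin
    ∑ e′                ≡⟨ m+n∸n≡m (∑ e′) 4 ⟨
    ∑ e′ + 4 ∸ 4        ≡⟨ cong (_∸ 4) (+-comm (∑ e′) 4) ⟩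
    3 + (1 + ∑ e′) ∸ 4  ≡⟨ cong (λ k → 3 + k ∸ 4) (+-comm 1 (∑ e′)) ⟩
    3 + (∑ e′ + 1) ∸ 4  ≡⟨ cong (λ k → 3 + (∑ e′ + k) ∸ 4) (count-== z) ⟨
    3 + (∑ e′ + count (_== z)) ∸ 4 ≡⟨ cong (λ k → 3 + k ∸ 4) (∑-distrib-+ e′ (bit ∘ (_== z))) ⟨
    ∑ (splitDegrees e′ z) ∸ 4 ≡⟨ cong (_∸ 4) (sum-cong-≗ splitDegrees-e′≗e) ⟩
    ∑ e ∸ 4             ≡⟨ cong (_∸ 4) ∑≡4M ⟩
    4 * M ∸ 4           ∎
    where open ≡-Reasoning

  e′-last : 5 ≤ e′ (fromℕ M)
  e′-last with fromℕ M == z in last==z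
  ... | false = 5≤last
  ... | true  = ∸-monoˡ-≤ 1 (+-cancelˡ-≤ 3 6 E (≤-trans 9≤M (+-cancelˡ-≤ (M * 3) M (3 + E) (begin
    M * 3 + M                              ≡⟨ m3+m≡4m M ⟩
    4 * M                                  ≡⟨ ∑≡4M ⟨
    ∑ e                                    ≡⟨ cong₂ _+_ first≡3 (sum-init-last (e ∘ suc)) ⟩
    3 + (∑ (e ∘ suc ∘ inject₁) + E)        ≤⟨ +-monoʳ-≤ 3 (+-monoˡ-≤ E (∑≤* 3 (e ∘ suc ∘ inject₁) small)) ⟩
    3 + (M * 3 + E)                        ≡⟨ x+[y+z]≡y+[x+z] 3 (M * 3) E ⟩
    M * 3 + (3 + E)                        ∎))))
    where
    open ≤-Reasoning
    m3+m≡4m : ∀ m → m * 3 + m ≡ 4 * m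
    m3+m≡4m = solve-∀
    x+[y+z]≡y+[x+z] : ∀ x y z → x + (y + z) ≡ y + (x + z)
    x+[y+z]≡y+[x+z] = solve-∀
    E : ℕ
    E = e (suc (fromℕ M))
    small : ∀ v → e (suc (inject₁ v)) ≤ 3
    small v = ≤-pred (before-z (inject₁ v) (subst (λ k → toℕ (inject₁ v) < toℕ k) (==⇒≡ last==z)
                (subst₂ _<_ (sym (toℕ-inject₁ v)) (sym (toℕ-fromℕ M)) (toℕ<n v))))

  admissible′ : Admissible M e′
  admissible′ = record
    { nonDecreasing = e′-nonDecreasing ; first≡3 = e′-first ; 5≤last = e′-last ; ∑≡4m∸4 = e′-∑ }

baseDegrees-forced : ∀ {e} → Admissible 9 e → ∀ i → baseDegrees i ≡ e i
baseDegrees-forced {e} adm = ∑-mono-≤-equality baseDegrees≤e (sym ∑≡4m∸4)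
  where
  open Admissible adm
  baseDegrees≤e : ∀ i → baseDegrees i ≤ e i
  baseDegrees≤e i with i == fromℕ 9 in i==9
  ... | true  = subst (λ k → 5 ≤ e k) (sym (==⇒≡ i==9)) 5≤last
  ... | false = 3≤ i

splittable-admissible : ∀ k {e} → Admissible (9 + k) e → Splittable (10 + k) e
splittable-admissible zero    adm = splittable-cong baseSplittable (baseDegrees-forced adm)
splittable-admissible (suc k) adm = splittable-cong
  (splittable-split (splittable-admissible k admissible′) z) splitDegrees-e′≗e
  where open Unsplit adm (m≤m+n 9 k)

admissible-realization : ∀ {m e} → Admissible m e → C4PivotRealization (suc m) e
admissible-realization {m} adm with m ∸ 9 | m+[n∸m]≡n (admissible⇒9≤m adm)
... | k | refl = Splittable.realization (splittable-admissible k adm)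

opposite-antitone : ∀ {n} {i j : Fin n} → i ≤ᶠ j → opposite j ≤ᶠ opposite i
opposite-antitone {suc n} {i} {j} i≤j =
  subst₂ _≤_ (sym (opposite-prop j)) (sym (opposite-prop i)) (∸-monoʳ-≤ (suc n) (s≤s i≤j))

lemma4p5 : (m : ℕ) (d : Fin (suc m) → ℕ) →
    Graphical d →
    sum (map d (allFin (suc m))) ≡ 4 * m ∸ 4 →
    5 ≤ d zero → d zero < m →
    d (fromℕ m) ≡ 3 →
    Σ (Graph (suc m)) (λ G → Realizes G d × C4Pivotable G)
lemma4p5 m d (nonIncreasing , _) ∑d≡4m∸4 5≤d₀ _ d-last≡3 = union , realizes , realization-C4Pivotable R ∑d≡
  where
  ∑d≡ : ∑ d ≡ 4 * m ∸ 4
  ∑d≡ = trans (sym (sum-map-tabulate d id)) ∑d≡4m∸4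
  reversed : Admissible m (d ∘ opposite)
  reversed = record
    { nonDecreasing = λ i j i≤j → nonIncreasing (opposite j) (opposite i) (opposite-antitone i≤j)
    ; first≡3       = d-last≡3
    ; 5≤last        = subst (λ k → 5 ≤ d k) (sym (opposite-involutive zero)) 5≤d₀
    ; ∑≡4m∸4        = trans (sym (sum-permute d Perm.reverse)) ∑d≡
    }
  R : C4PivotRealization (suc m) d
  R = realization-cong (relabel Perm.reverse (admissible-realization reversed)) (cong d ∘ opposite-involutive)
  open C4PivotRealization R using (union; realizes)
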